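{- The pair $(\mathbb A_{12},\mathbb A_{21})$ defined in the context is a bi-asimulation between $\mathcal M_1$ and $\mathcal M_2$, and $((\mathbf v,()),(\mathbf w,()))\in\mathbb A_{12}$ (where $()$ is the empty tuple).
   Context: $\mathbb N=\{1,2,3,\dots\}$. A quasi-partition is a triple $(A,B,C)$ of pairwise disjoint subsets of $\mathbb N$ with $A\cup B\cup C=\mathbb N$, $A,C$ infinite, $B$ empty or infinite; $W$ is the set of all quasi-partitions. $(A,B,C)\trianglelefteq(D,E,F)$ iff $A\subseteq D$ and $F\subseteq C$. $\mathbf v=(\mathbf v_1,\mathbf v_2,\mathbf v_3)$ with $\mathbf v_r=\{n\in\mathbb N:n\equiv r-1\pmod 3\}$; $\mathbf w=(\mathbf w_1,\emptyset,\mathbf w_3)$ with $\mathbf w_1$ the even and $\mathbf w_3$ the odd elements of $\mathbb N$. Models $\mathcal M_i=(W,\prec_i,\mathbb N,V_i)$, $i=1,2$, for unary predicates $P,Q$: $\prec_2=\trianglelefteq$; $(A,B,C)\prec_1(D,E,F)$ iff $(A,B,C)\trianglelefteq(D,E,F)$ and [if $\mathbf v\trianglelefteq(A,B,C)$ and $B\cap\mathbf v_2$ infinite then $E\cap\mathbf v_2$ infinite]; $V_i(P,(A,B,C))=A\cup B$, $V_i(Q,(A,B,C))=A$. For $(i,j)\in\{(1,2),(2,1)\}$, $\mathbb A_{ij}$ is the set of pairs $(((A,B,C),\bar a_n),((D,E,F),\bar b_n))$ with $(A,B,C),(D,E,F)\in W$, $n\ge0$, $\bar a_n,\bar b_n\in\mathbb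 N^n$ such that: (a) $\{(a_k,b_k)\}$ is a bijection; (b) $a_k\in A\Rightarrow b_k\in D$; (c) $a_k\in B\Rightarrow b_k\in D\cup E$ (first component in $\mathcal M_i$, second in $\mathcal M_j$). A bi-asimulation between models $\mathcal M_1,\mathcal M_2$ (worlds $W_i$, preorders $\prec_i$, domains $D_i$) is a pair $(A_{12},A_{21})$, not both empty, $A_{ij}\subseteq\bigcup_n(W_i\times D_i^n)\times(W_j\times D_j^n)$, such that for each $(i,j)$ and $((w,\bar a_n),(v,\bar b_n))\in A_{ij}$: (atom) for each predicate $R$ of arity $m$ and $k_1,\dots,k_m\le n$, $(a_{k_1},\dots,a_{k_m})\in V_i(R,w)$ implies $(b_{k_1},\dots,b_{k_m})\in V_j(R,v)$; (back) for all $v_0$ with $v\prec_j v_0$ there is $w_0$ with $w\prec_i w_0$, $((w_0,\bar a_n),(v_0,\bar b_n))\in A_{ij}$ and $((v_0,\bar b_n),(w_0,\bar a_n))\in A_{ji}$; (forth) for all $w_0\prec_i w$ there is $v_0\prec_j v$ with the same two memberships; (left) for all $b\in D_j$ there is $a\in D_i$ with $((w,\bar a_n a),(v,\bar b_n b))\in A_{ij}$; (right) for all $a\in D_i$ there is $b\in D_j$ with $((w,\bar a_n a),(v,\bar b_n b))\in A_{ij}$. -}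

module Defs where

open import Level using (0ℓ)
open import Data.Nat using (ℕ; zero; suc; _+_; _*_; _≤_; _%_)
open import Data.Nat.Properties using (m≤m*n; m≤n+m; ≤-trans)
open import Data.Nat.DivMod using ([m+kn]%n≡m%n; m%n<n)
import Data.Nat
open import Data.Fin using (Fin)
open import Data.Vec using (Vec; []; _∷_; _∷ʳ_; lookup; map)
open import Data.Product using (Σ; Σ-syntax; ∃; ∃-syntax; _×_; _,_)
open import Data.Sum using (_⊎_; inj₁; inj₂)
open import Data.Empty using (⊥)
open import Relation.Nullary using (¬_)
open import Relation.Unary using (Pred; _⊆_; _∩_; Empty)
open import Relation.Binary.PropositionalEquality using (_≡_; refl; sym; trans)
open import Function.Bundles using (_⇔_)

record Signature : Set₁ where
  field
    Sym   : Set
    arity : Sym → ℕ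

record Model (S : Signature) : Set₂ where
  open Signature S
  field
    World : Set₁
    _≺_   : World → World → Set
    Dom   : Set
    V     : (R : Sym) → World → Vec Dom (arity R) → Set

Rel : ∀ {S} → Model S → Model S → Set₁
Rel M N = (n : ℕ) → Model.World M → Vec (Model.Dom M) n
                  → Model.World N → Vec (Model.Dom N) n → Set

record Conditions {S : Signature} (M N : Model S) (Aij : Rel M N) (Aji : Rel N M)
                  (n : ℕ) (w : Model.World M) (as : Vec (Model.Dom M) n)
                  (v : Model.World N) (bs : Vec (Model.Dom N) n) : Set₁ where
  open Signature S
  private
    module M = Model M
    module N = Model N
  field
    atom  : (R : Sym) (ks : Vec (Fin n) (arity R)) →
            M.V R w (map (lookup as) ks) → N.V R v (map (lookup bs) ks)
    back  : (v₀ : N.World) → v N.≺ v₀ →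
            Σ[ w₀ ∈ M.World ] (w M.≺ w₀ × Aij n w₀ as v₀ bs × Aji n v₀ bs w₀ as)
    forth : (w₀ : M.World) → w₀ M.≺ w →
            Σ[ v₀ ∈ N.World ] (v₀ N.≺ v × Aij n w₀ as v₀ bs × Aji n v₀ bs w₀ as)
    left  : (b : N.Dom) → Σ[ a ∈ M.Dom ] Aij (suc n) w (as ∷ʳ a) v (bs ∷ʳ b)
    right : (a : M.Dom) → Σ[ b ∈ N.Dom ] Aij (suc n) w (as ∷ʳ a) v (bs ∷ʳ b)

record IsBiAsimulation {S : Signature} (M₁ M₂ : Model S)
                       (A₁₂ : Rel M₁ M₂) (A₂₁ : Rel M₂ M₁) : Set₁ where
  private
    module M₁ = Model M₁
    module M₂ = Model M₂
  field
    nonempty : (Σ[ n ∈ ℕ ] Σ[ w ∈ M₁.World ] Σ[ as ∈ Vec M₁.Dom n ]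
                Σ[ v ∈ M₂.World ] Σ[ bs ∈ Vec M₂.Dom n ] A₁₂ n w as v bs)
             ⊎ (Σ[ n ∈ ℕ ] Σ[ w ∈ M₂.World ] Σ[ as ∈ Vec M₂.Dom n ]
                Σ[ v ∈ M₁.World ] Σ[ bs ∈ Vec M₁.Dom n ] A₂₁ n w as v bs)
    cond₁₂ : ∀ n w as v bs → A₁₂ n w as v bs → Conditions M₁ M₂ A₁₂ A₂₁ n w as v bs
    cond₂₁ : ∀ n w as v bs → A₂₁ n w as v bs → Conditions M₂ M₁ A₂₁ A₁₂ n w as v bs

-- The concrete setting.  CONVENTION: the paper's ℕ = {1,2,3,…} is
-- represented by Agda's ℕ, the Agda number k standing for k+1.

Infinite : Pred ℕ 0ℓ → Set
Infinite X = ∀ n → ∃[ m ] (n ≤ m × X m)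

record QP : Set₁ where
  constructor qp
  field
    A B C  : Pred ℕ 0ℓ
    disjAB : ∀ k → ¬ (A k × B k)
    disjAC : ∀ k → ¬ (A k × C k)
    disjBC : ∀ k → ¬ (B k × C k)
    cover  : ∀ k → A k ⊎ B k ⊎ C k
    infA   : Infinite A
    infC   : Infinite C
    B-empty-or-infinite : Empty B ⊎ Infinite B
open QP public

_⊴_ : QP → QP → Set
x ⊴ y = (A x ⊆ A y) × (C y ⊆ C x)

v₁ v₂ v₃ : Pred ℕ 0ℓ
v₁ k = suc k % 3 ≡ 0
v₂ k = suc k % 3 ≡ 1
v₃ k = suc k % 3 ≡ 2

private
  ≤-pad : ∀ c n → n ≤ c + n * 3
  ≤-pad c n = ≤-trans (m≤m*n n 3) (m≤n+m (n * 3) c)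

  v-cover : ∀ k → v₁ k ⊎ v₂ k ⊎ v₃ k
  v-cover k with suc k % 3 | m%n<n (suc k) 3
  ... | 0 | _ = inj₁ refl
  ... | 1 | _ = inj₂ (inj₁ refl)
  ... | 2 | _ = inj₂ (inj₂ refl)
  ... | suc (suc (suc _)) | Data.Nat.s≤s (Data.Nat.s≤s (Data.Nat.s≤s ()))

  d01 : ∀ {x : ℕ} → x ≡ 0 → x ≡ 1 → ⊥
  d01 p q with trans (sym p) q
  ... | ()
  d02 : ∀ {x : ℕ} → x ≡ 0 → x ≡ 2 → ⊥
  d02 p q with trans (sym p) q
  ... | ()
  d12 : ∀ {x : ℕ} → x ≡ 1 → x ≡ 2 → ⊥
  d12 p q with trans (sym p) q
  ... | ()

𝐯 : QP
𝐯 = record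
  { A = v₁ ; B = v₂ ; C = v₃
  ; disjAB = λ { k (p , q) → d01 p q }
  ; disjAC = λ { k (p , q) → d02 p q }
  ; disjBC = λ { k (p , q) → d12 p q }
  ; cover  = v-cover
  ; infA = λ n → 2 + n * 3 , ≤-pad 2 n , [m+kn]%n≡m%n 0 (suc n) 3
  ; infC = λ n → 4 + n * 3 , ≤-pad 4 n , [m+kn]%n≡m%n 2 (suc n) 3
  ; B-empty-or-infinite = inj₂ (λ n → 3 + n * 3 , ≤-pad 3 n , [m+kn]%n≡m%n 1 (suc n) 3)
  }

evens odds : Pred ℕ 0ℓ
evens k = suc k % 2 ≡ 0
odds  k = suc k % 2 ≡ 1

private
  ≤-pad2 : ∀ c n → n ≤ c + n * 2
  ≤-pad2 c n = ≤-trans (m≤m*n n 2) (m≤n+m (n * 2) c)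

  eo-cover : ∀ k → evens k ⊎ (λ _ → ⊥) k ⊎ odds k
  eo-cover k with suc k % 2 | m%n<n (suc k) 2
  ... | 0 | _ = inj₁ refl
  ... | 1 | _ = inj₂ (inj₂ refl)
  ... | suc (suc _) | Data.Nat.s≤s (Data.Nat.s≤s ())

𝐰 : QP
𝐰 = record
  { A = evens ; B = λ _ → ⊥ ; C = odds
  ; disjAB = λ { k (_ , ()) }
  ; disjAC = λ { k (p , q) → d01 p q }
  ; disjBC = λ { k (() , _) }
  ; cover  = eo-cover
  ; infA = λ n → 1 + n * 2 , ≤-pad2 1 n , [m+kn]%n≡m%n 0 (suc n) 2
  ; infC = λ n → 2 + n * 2 , ≤-pad2 2 n , [m+kn]%n≡m%n 1 (suc n) 2
  ; B-empty-or-infinite = inj₁ (λ _ ())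
  }

_≺₂_ : QP → QP → Set
_≺₂_ = _⊴_

_≺₁_ : QP → QP → Set
x ≺₁ y = (x ⊴ y) × (𝐯 ⊴ x → Infinite (B x ∩ v₂) → Infinite (B y ∩ v₂))

data PQ : Set where
  P Q : PQ

Sig : Signature
Sig = record { Sym = PQ ; arity = λ _ → 1 }

Val : (R : PQ) → QP → Vec ℕ 1 → Set
Val P x (a ∷ []) = A x a ⊎ B x a
Val Q x (a ∷ []) = A x a

M₁ M₂ : Model Sig
M₁ = record { World = QP ; _≺_ = _≺₁_ ; Dom = ℕ ; V = Val }
M₂ = record { World = QP ; _≺_ = _≺₂_ ; Dom = ℕ ; V = Val }

𝔸 : (n : ℕ) → QP → Vec ℕ n → QP → Vec ℕ n → Set
𝔸 n x as y bs =
    (∀ k l → (lookup as k ≡ lookup as l) ⇔ (lookup bs k ≡ lookup bs l))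
  × (∀ k → A x (lookup as k) → A y (lookup bs k))
  × (∀ k → B x (lookup as k) → A y (lookup bs k) ⊎ B y (lookup bs k))

𝔸₁₂ : Rel M₁ M₂
𝔸₁₂ = 𝔸

𝔸₂₁ : Rel M₂ M₁
𝔸₂₁ = 𝔸

-- 𝔸 only requires each tuple point to be sent to a part at least as far left as its own in the
-- order A, B, C.  For (back) and (forth) the required world copies the parts of the other world
-- on the tuple, keeps the old world elsewhere, and turns an infinite set of fresh points, carved
-- out of C for (back) and out of A for (forth), into B-points, so that B is infinite.  The extra
-- clause of ≺₁ needs care only in (forth): there the new B-points must avoid 𝐯₂, which can be
-- arranged when A ∖ 𝐯₂ is infinite; when it is finite the premise 𝐯 ⊴ v₀ of the clause fails.
-- (left) and (right) extend the tuple by a point already in it, or else by a fresh point of C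
-- (resp. of A), about which 𝔸 demands nothing (resp. everything it demands holds).
module Submission where

open import Defs
open import Level using (0ℓ)
open import Axiom.ExcludedMiddle using (ExcludedMiddle)
open import Data.Empty using (⊥-elim)
open import Data.Fin using (Fin; zero; suc)
open import Data.Nat using (ℕ; zero; suc; _≤_; _<_; _⊔_; _*_; _≟_; z≤n; s≤s)
open import Data.Nat.Properties
  using (≤-trans; <-trans; <-irrefl; <-cmp; m≤m⊔n; m≤n⊔m; m≤n*m; n≤1+n; m≤n⇒m<n∨m≡n; even≢odd)
import Data.Product as Product
open Product using (_×_; Σ-syntax; ∃-syntax; _,_; proj₁; proj₂; swap)
open import Data.Sum using (_⊎_; inj₁; inj₂)
open import Data.Vec using (Vec; []; _∷_; _∷ʳ_; lookup; map)
open import Data.Vec.Membership.DecPropositional _≟_ using (_∈_; _∉_; _∈?_)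
open import Data.Vec.Membership.Propositional.Properties using (∈-lookup)
open import Data.Vec.Relation.Unary.Any using (here; there; index)
open import Data.Vec.Relation.Unary.Any.Properties using (lookup-index)
open import Function using (id; _∘_)
open import Function.Bundles using (_⇔_; mk⇔; Equivalence)
open import Function.Properties.Equivalence using () renaming (sym to ⇔-sym)
open import Relation.Nullary using (¬_; yes; no)
open import Relation.Unary using (Pred; _⊆_; _∩_; ∁)
open import Relation.Binary.Definitions using (tri<; tri≈; tri>)
open import Relation.Binary.PropositionalEquality using (_≡_; _≢_; refl; sym; trans; subst; cong)

Infinite-mono : ∀ {P Q : Pred ℕ 0ℓ} → P ⊆ Q → Infinite P → Infinite Q
Infinite-mono P⊆Q inf N = let m , N≤m , Pm = inf N in m , N≤m , P⊆Q Pm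

Infinite-∉ : ∀ {n} {P : Pred ℕ 0ℓ} (as : Vec ℕ n) → Infinite P → Infinite (λ m → P m × m ∉ as)
Infinite-∉ [] inf N = let m , N≤m , Pm = inf N in m , N≤m , Pm , λ ()
Infinite-∉ (a ∷ as) inf N =
  let m , bound≤m , Pm , m∉as = Infinite-∉ as inf (N ⊔ suc a)
      a<m = ≤-trans (m≤n⊔m N (suc a)) bound≤m
  in m , ≤-trans (m≤m⊔n N (suc a)) bound≤m , Pm ,
     λ { (here m≡a) → <-irrefl (sym m≡a) a<m ; (there m∈as) → m∉as m∈as }

module Enumeration {X : Pred ℕ 0ℓ} (inf : Infinite X) where

  enum : ℕ → ℕ
  enum zero    = proj₁ (inf 0)
  enum (suc i) = proj₁ (inf (suc (enum i)))

  enum-∈ : ∀ i → X (enum i)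
  enum-∈ zero    = proj₂ (proj₂ (inf 0))
  enum-∈ (suc i) = proj₂ (proj₂ (inf (suc (enum i))))

  enum-<-suc : ∀ i → enum i < enum (suc i)
  enum-<-suc i = proj₁ (proj₂ (inf (suc (enum i))))

  enum-≥ : ∀ i → i ≤ enum i
  enum-≥ zero    = z≤n
  enum-≥ (suc i) = ≤-trans (s≤s (enum-≥ i)) (enum-<-suc i)

  enum-strict : ∀ {i j} → i < j → enum i < enum j
  enum-strict {i} {suc j} (s≤s i≤j) with m≤n⇒m<n∨m≡n i≤j
  ... | inj₁ i<j  = <-trans (enum-strict i<j) (enum-<-suc j)
  ... | inj₂ refl = enum-<-suc j

  enum-injective : ∀ {i j} → enum i ≡ enum j → i ≡ j
  enum-injective {i} {j} eq with <-cmp i j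
  ... | tri< i<j _ _ = ⊥-elim (<-irrefl eq (enum-strict i<j))
  ... | tri≈ _ i≡j _ = i≡j
  ... | tri> _ _ j<i = ⊥-elim (<-irrefl (sym eq) (enum-strict j<i))

Infinite-split : ∀ {X : Pred ℕ 0ℓ} → Infinite X →
                 Σ[ E ∈ Pred ℕ 0ℓ ] (E ⊆ X × Infinite E × Infinite (X ∩ ∁ E))
Infinite-split {X} inf = E , E⊆X , E-inf , rest-inf
  where
  open Enumeration inf

  E : Pred ℕ 0ℓ
  E k = ∃[ i ] enum (2 * i) ≡ k

  E⊆X : E ⊆ X
  E⊆X (i , refl) = enum-∈ (2 * i)

  E-inf : Infinite E
  E-inf N = enum (2 * N) , ≤-trans (m≤n*m N 2) (enum-≥ (2 * N)) , N , refl

  rest-inf : Infinite (X ∩ ∁ E)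
  rest-inf N = enum (suc (2 * N))
             , ≤-trans (≤-trans (m≤n*m N 2) (n≤1+n (2 * N))) (enum-≥ (suc (2 * N)))
             , enum-∈ (suc (2 * N))
             , λ (i , eq) → even≢odd i N (enum-injective eq)

Infinite-avoiding : ExcludedMiddle 0ℓ → ∀ {Z Y : Pred ℕ 0ℓ} → Infinite Z →
                    Σ[ X ∈ Pred ℕ 0ℓ ] (X ⊆ Z × Infinite X × (Infinite (Z ∩ ∁ Y) → X ⊆ ∁ Y))
Infinite-avoiding em {Z} {Y} inf with em {Infinite (Z ∩ ∁ Y)}
... | yes inf′ = Z ∩ ∁ Y , proj₁ , inf′ , λ _ → proj₂
... | no ¬inf′ = Z , id , inf , λ inf′ → ⊥-elim (¬inf′ inf′)

lookup-or-∉ : ∀ {n} (as : Vec ℕ n) k → (∃[ i ] lookup as i ≡ k) ⊎ k ∉ as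
lookup-or-∉ as k with k ∈? as
... | yes k∈as = inj₁ (index k∈as , sym (lookup-index k∈as))
... | no k∉as  = inj₂ k∉as

lookup-≢-∉ : ∀ {n} {as : Vec ℕ n} {k} → k ∉ as → ∀ i → lookup as i ≢ k
lookup-≢-∉ {as = as} k∉as i eq = k∉as (subst (_∈ as) eq (∈-lookup i as))

data Part : Set where
  inA inB inC : Part

Member : Part → QP → Pred ℕ 0ℓ
Member inA = A
Member inB = B
Member inC = C

part : QP → ℕ → Part
part x k with cover x k
... | inj₁ _        = inA
... | inj₂ (inj₁ _) = inB
... | inj₂ (inj₂ _) = inC

member-part : ∀ x k → Member (part x k) x k
member-part x k with cover x k
... | inj₁ a        = a
... | inj₂ (inj₁ b) = b
... | inj₂ (inj₂ c) = c

member-unique : ∀ x {k} p q → Member p x k → Member q x k → p ≡ q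
member-unique x inA inA _ _ = refl
member-unique x inB inB _ _ = refl
member-unique x inC inC _ _ = refl
member-unique x inA inB a b = ⊥-elim (disjAB x _ (a , b))
member-unique x inA inC a c = ⊥-elim (disjAC x _ (a , c))
member-unique x inB inA b a = ⊥-elim (disjAB x _ (a , b))
member-unique x inB inC b c = ⊥-elim (disjBC x _ (b , c))
member-unique x inC inA c a = ⊥-elim (disjAC x _ (a , c))
member-unique x inC inB c b = ⊥-elim (disjBC x _ (b , c))

part-unique : ∀ x {k} p → Member p x k → part x k ≡ p
part-unique x p = member-unique x _ p (member-part x _)

part⇒member : ∀ x {k p} → part x k ≡ p → Member p x k
part⇒member x {k} refl = member-part x k

fromColouring : (t : ℕ → Part) → Infinite (λ k → t k ≡ inA) → Infinite (λ k → t k ≡ inB) →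
                Infinite (λ k → t k ≡ inC) → QP
fromColouring t ia ib ic = record
  { A = λ k → t k ≡ inA ; B = λ k → t k ≡ inB ; C = λ k → t k ≡ inC
  ; disjAB = λ _ → distinct λ ()
  ; disjAC = λ _ → distinct λ ()
  ; disjBC = λ _ → distinct λ ()
  ; cover = λ k → covers (t k)
  ; infA = ia ; infC = ic ; B-empty-or-infinite = inj₂ ib
  }
  where
  distinct : ∀ {p q c : Part} → p ≢ q → ¬ (c ≡ p × c ≡ q)
  distinct p≢q (refl , c≡q) = p≢q c≡q

  covers : ∀ c → c ≡ inA ⊎ c ≡ inB ⊎ c ≡ inC
  covers inA = inj₁ refl
  covers inB = inj₂ (inj₁ refl)
  covers inC = inj₂ (inj₂ refl)

part-fromColouring : ∀ t ia ib ic k → part (fromColouring t ia ib ic) k ≡ t k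
part-fromColouring t ia ib ic k = part-unique (fromColouring t ia ib ic) (t k) (member k)
  where
  member : ∀ k → Member (t k) (fromColouring t ia ib ic) k
  member k with t k in eq
  ... | inA = eq
  ... | inB = eq
  ... | inC = eq

Matching : ∀ {n} → Vec ℕ n → Vec ℕ n → Set
Matching as bs = ∀ k l → (lookup as k ≡ lookup as l) ⇔ (lookup bs k ≡ lookup bs l)

Matching-sym : ∀ {n} (as bs : Vec ℕ n) → Matching as bs → Matching bs as
Matching-sym _ _ matching k l = ⇔-sym (matching k l)

𝔸-samePart : ∀ {n} x (as : Vec ℕ n) y bs → Matching as bs →
             (∀ i → part x (lookup as i) ≡ part y (lookup bs i)) → 𝔸 n x as y bs
𝔸-samePart x as y bs matching same =
  matching ,
  (λ i a → part⇒member y (trans (sym (same i)) (part-unique x inA a))) ,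
  (λ i b → inj₂ (part⇒member y (trans (sym (same i)) (part-unique x inB b))))

𝔸-reflects-C : ∀ {n} x (as : Vec ℕ n) y bs → 𝔸 n x as y bs →
               ∀ i → C y (lookup bs i) → C x (lookup as i)
𝔸-reflects-C x as y bs (_ , A⇒A , B⇒AB) i c with cover x (lookup as i)
... | inj₁ a         = ⊥-elim (disjAC y _ (A⇒A i a , c))
... | inj₂ (inj₂ c′) = c′
... | inj₂ (inj₁ b) with B⇒AB i b
...   | inj₁ a = ⊥-elim (disjAC y _ (a , c))
...   | inj₂ b = ⊥-elim (disjBC y _ (b , c))

module Relocation (em : ExcludedMiddle 0ℓ) {n} (x y : QP) (as bs : Vec ℕ n)
                  (matching : Matching as bs) (E : Pred ℕ 0ℓ) where

  colour : ℕ → Part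
  colour k with k ∈? as
  ... | yes k∈as = part y (lookup bs (index k∈as))
  ... | no _ with em {E k}
  ...   | yes _ = inB
  ...   | no _  = part x k

  colour-lookup : ∀ i → colour (lookup as i) ≡ part y (lookup bs i)
  colour-lookup i with lookup as i ∈? as
  ... | yes p    = cong (part y) (Equivalence.to (matching (index p) i) (sym (lookup-index p)))
  ... | no i∉as = ⊥-elim (i∉as (∈-lookup i as))

  colour-marked : ∀ {k} → k ∉ as → E k → colour k ≡ inB
  colour-marked {k} k∉as e with k ∈? as
  ... | yes k∈as = ⊥-elim (k∉as k∈as)
  ... | no _ with em {E k}
  ...   | yes _ = refl
  ...   | no ¬e = ⊥-elim (¬e e)

  colour-unmarked : ∀ {k} → k ∉ as → ¬ E k → colour k ≡ part x k
  colour-unmarked {k} k∉as ¬e with k ∈? as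
  ... | yes k∈as = ⊥-elim (k∉as k∈as)
  ... | no _ with em {E k}
  ...   | yes e = ⊥-elim (¬e e)
  ...   | no _  = refl

  colour-fresh-B : ∀ {k} → k ∉ as → B x k → colour k ≡ inB
  colour-fresh-B {k} k∉as b with em {E k}
  ... | yes e = colour-marked k∉as e
  ... | no ¬e = trans (colour-unmarked k∉as ¬e) (part-unique x inB b)

  colour-⊇ : ∀ p → (∀ i → Member p x (lookup as i) → Member p y (lookup bs i)) →
             (∀ {k} → E k → ¬ Member p x k) → ∀ {k} → Member p x k → colour k ≡ p
  colour-⊇ p along E-avoids {k} m with lookup-or-∉ as k
  ... | inj₁ (i , refl) = trans (colour-lookup i) (part-unique y p (along i m))
  ... | inj₂ k∉as       = trans (colour-unmarked k∉as (λ e → E-avoids e m)) (part-unique x p m)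

  colour-⊆ : ∀ p → p ≢ inB → (∀ i → Member p y (lookup bs i) → Member p x (lookup as i)) →
             ∀ {k} → colour k ≡ p → Member p x k
  colour-⊆ p p≢B along {k} c with lookup-or-∉ as k
  ... | inj₁ (i , refl) = along i (part⇒member y (trans (sym (colour-lookup i)) c))
  ... | inj₂ k∉as with em {E k}
  ...   | yes e = ⊥-elim (p≢B (trans (sym c) (colour-marked k∉as e)))
  ...   | no ¬e = part⇒member x (trans (sym (colour-unmarked k∉as ¬e)) c)

  colour-infinite : ∀ p → Infinite (Member p x ∩ ∁ E) → Infinite (λ k → colour k ≡ p)
  colour-infinite p inf = Infinite-mono
    (λ ((m , ¬e) , k∉as) → trans (colour-unmarked k∉as ¬e) (part-unique x p m))
    (Infinite-∉ as inf)

  colour-B-∩ : ∀ {Y : Pred ℕ 0ℓ} → Infinite (B x ∩ Y) → Infinite ((λ k → colour k ≡ inB) ∩ Y)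
  colour-B-∩ inf = Infinite-mono
    (λ ((b , y) , k∉as) → colour-fresh-B k∉as b , y)
    (Infinite-∉ as inf)

  colour-B-∩⁻ : ∀ {Y : Pred ℕ 0ℓ} → (∀ {k} → E k → ¬ Y k) →
                Infinite ((λ k → colour k ≡ inB) ∩ Y) → Infinite (B x ∩ Y)
  colour-B-∩⁻ E-avoids inf = Infinite-mono
    (λ ((c , y) , k∉as) → part⇒member x (trans (sym (colour-unmarked k∉as (λ e → E-avoids e y))) c) , y)
    (Infinite-∉ as inf)

  relocated : Infinite (λ k → colour k ≡ inA) → Infinite E → Infinite (λ k → colour k ≡ inC) → QP
  relocated ia E-inf ic = fromColouring colour ia (Infinite-mono (λ (e , k∉as) → colour-marked k∉as e)
                                                                (Infinite-∉ as E-inf)) ic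

  𝔸-relocated : ∀ ia E-inf ic → let z = relocated ia E-inf ic in 𝔸 n z as y bs × 𝔸 n y bs z as
  𝔸-relocated ia E-inf ic = 𝔸-samePart _ as y bs matching same ,
                            𝔸-samePart y bs _ as (Matching-sym as bs matching) (sym ∘ same)
    where
    same : ∀ i → part (relocated ia E-inf ic) (lookup as i) ≡ part y (lookup bs i)
    same i = trans (part-fromColouring colour _ _ _ (lookup as i)) (colour-lookup i)

𝔸-back : ExcludedMiddle 0ℓ → ∀ {n} w (as : Vec ℕ n) v bs → 𝔸 n w as v bs → ∀ v₀ → v ⊴ v₀ →
         Σ[ w₀ ∈ QP ] (w ≺₁ w₀ × 𝔸 n w₀ as v₀ bs × 𝔸 n v₀ bs w₀ as)
𝔸-back em w as v bs R@(matching , A⇒A , _) v₀ (Av⊆Av₀ , Cv₀⊆Cv)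
  with Infinite-split (infC w)
... | E , E⊆C , E-inf , C∖E-inf =
  w₀ , ((A-up , C-down) , λ _ → colour-B-∩) , 𝔸-relocated ia E-inf ic
  where
  open Relocation em w v₀ as bs matching E

  E-avoids-A : ∀ {k} → E k → ¬ A w k
  E-avoids-A e a = disjAC w _ (a , E⊆C e)

  ia : Infinite (λ k → colour k ≡ inA)
  ia = colour-infinite inA (Infinite-mono (λ a → a , λ e → E-avoids-A e a) (infA w))

  ic : Infinite (λ k → colour k ≡ inC)
  ic = colour-infinite inC C∖E-inf

  w₀ : QP
  w₀ = relocated ia E-inf ic

  A-up : A w ⊆ A w₀
  A-up = colour-⊇ inA (λ i a → Av⊆Av₀ (A⇒A i a)) E-avoids-A

  C-down : C w₀ ⊆ C w
  C-down = colour-⊆ inC (λ ()) (λ i c → 𝔸-reflects-C w as v bs R i (Cv₀⊆Cv c))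

𝔸-forth : ExcludedMiddle 0ℓ → ∀ {n} w (as : Vec ℕ n) v bs → 𝔸 n w as v bs → ∀ w₀ → w₀ ⊴ w →
          Σ[ v₀ ∈ QP ] (v₀ ≺₁ v × 𝔸 n w₀ as v₀ bs × 𝔸 n v₀ bs w₀ as)
𝔸-forth em w as v bs R@(matching , A⇒A , _) w₀ (Aw₀⊆Aw , Cw⊆Cw₀)
  with Infinite-avoiding em {Y = v₂} (infA v)
... | X , X⊆A , X-inf , X-avoids with Infinite-split X-inf
... | E , E⊆X , E-inf , X∖E-inf =
  v₀ , ((A-down , C-up) , extra) , swap (𝔸-relocated ia E-inf ic)
  where
  open Relocation em v w₀ bs as (Matching-sym as bs matching) E

  E-avoids-C : ∀ {k} → E k → ¬ C v k
  E-avoids-C e c = disjAC v _ (X⊆A (E⊆X e) , c)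

  ia : Infinite (λ k → colour k ≡ inA)
  ia = colour-infinite inA (Infinite-mono (λ (x , ¬e) → X⊆A x , ¬e) X∖E-inf)

  ic : Infinite (λ k → colour k ≡ inC)
  ic = colour-infinite inC (Infinite-mono (λ c → c , λ e → E-avoids-C e c) (infC v))

  v₀ : QP
  v₀ = relocated ia E-inf ic

  A-down : A v₀ ⊆ A v
  A-down = colour-⊆ inA (λ ()) (λ i a → A⇒A i (Aw₀⊆Aw a))

  C-up : C v ⊆ C v₀
  C-up = colour-⊇ inC (λ i c → Cw⊆Cw₀ (𝔸-reflects-C w as v bs R i c)) E-avoids-C

  extra : 𝐯 ⊴ v₀ → Infinite (B v₀ ∩ v₂) → Infinite (B v ∩ v₂)
  extra (v₁⊆A , _) = colour-B-∩⁻ (λ e → X-avoids A∖v₂-inf (E⊆X e))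
    where
    A∖v₂-inf : Infinite (A v ∩ ∁ v₂)
    A∖v₂-inf = Infinite-mono (λ {k} v1 → A-down (v₁⊆A v1) , λ v2 → disjAB 𝐯 k (v1 , v2)) (infA 𝐯)

pointwise-∷ʳ : ∀ {S T : Set} (R : S → T → Set) {n} (as : Vec S n) (bs : Vec T n) {a b} →
               (∀ j → R (lookup as j) (lookup bs j)) → R a b →
               ∀ k → R (lookup (as ∷ʳ a) k) (lookup (bs ∷ʳ b) k)
pointwise-∷ʳ R []       []       _  r zero    = r
pointwise-∷ʳ R (_ ∷ _)  (_ ∷ _)  rs r zero    = rs zero
pointwise-∷ʳ R (_ ∷ as) (_ ∷ bs) rs r (suc k) = pointwise-∷ʳ R as bs (rs ∘ suc) r k

𝔸-∷ʳ : ∀ {n} x (as : Vec ℕ n) y bs {a b} → 𝔸 n x as y bs →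
       (∀ j → (lookup as j ≡ a) ⇔ (lookup bs j ≡ b)) →
       (A x a → A y b) → (B x a → A y b ⊎ B y b) → 𝔸 (suc n) x (as ∷ʳ a) y (bs ∷ʳ b)
𝔸-∷ʳ x as y bs {a} {b} (matching , A⇒A , B⇒AB) new a⇒ b⇒ =
  matching′ ,
  pointwise-∷ʳ (λ m m′ → A x m → A y m′) as bs A⇒A a⇒ ,
  pointwise-∷ʳ (λ m m′ → B x m → A y m′ ⊎ B y m′) as bs B⇒AB b⇒
  where
  flip-≡ : ∀ {m m′ n n′ : ℕ} → (m ≡ n) ⇔ (m′ ≡ n′) → (n ≡ m) ⇔ (n′ ≡ m′)
  flip-≡ e = mk⇔ (sym ∘ Equivalence.to e ∘ sym) (sym ∘ Equivalence.from e ∘ sym)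

  matching′ : Matching (as ∷ʳ a) (bs ∷ʳ b)
  matching′ k l = pointwise-∷ʳ (λ m m′ → (m ≡ lookup (as ∷ʳ a) l) ⇔ (m′ ≡ lookup (bs ∷ʳ b) l)) as bs
    (λ j → pointwise-∷ʳ (λ m m′ → (lookup as j ≡ m) ⇔ (lookup bs j ≡ m′)) as bs (matching j) (new j) l)
    (pointwise-∷ʳ (λ m m′ → (a ≡ m) ⇔ (b ≡ m′)) as bs (flip-≡ ∘ new) (mk⇔ (λ _ → refl) (λ _ → refl)) l)
    k

𝔸-∷ʳ-lookup : ∀ {n} x (as : Vec ℕ n) y bs → 𝔸 n x as y bs →
              ∀ j → 𝔸 (suc n) x (as ∷ʳ lookup as j) y (bs ∷ʳ lookup bs j)
𝔸-∷ʳ-lookup x as y bs R@(matching , A⇒A , B⇒AB) j = 𝔸-∷ʳ x as y bs R (λ i → matching i j) (A⇒A j) (B⇒AB j)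

𝔸-∷ʳ-∉ : ∀ {n} x (as : Vec ℕ n) y bs {a b} → 𝔸 n x as y bs → a ∉ as → b ∉ bs →
         (A x a → A y b) → (B x a → A y b ⊎ B y b) → 𝔸 (suc n) x (as ∷ʳ a) y (bs ∷ʳ b)
𝔸-∷ʳ-∉ x as y bs R a∉as b∉bs = 𝔸-∷ʳ x as y bs R (λ i → mk⇔ (⊥-elim ∘ lookup-≢-∉ a∉as i) (⊥-elim ∘ lookup-≢-∉ b∉bs i))

𝔸-left : ∀ {n} x (as : Vec ℕ n) y bs → 𝔸 n x as y bs →
         ∀ b → Σ[ a ∈ ℕ ] 𝔸 (suc n) x (as ∷ʳ a) y (bs ∷ʳ b)
𝔸-left x as y bs R b with lookup-or-∉ bs b
... | inj₁ (j , refl) = lookup as j , 𝔸-∷ʳ-lookup x as y bs R j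
... | inj₂ b∉bs =
  let m , _ , c , m∉as = Infinite-∉ as (infC x) 0
  in m , 𝔸-∷ʳ-∉ x as y bs R m∉as b∉bs (λ a → ⊥-elim (disjAC x m (a , c))) (λ b → ⊥-elim (disjBC x m (b , c)))

𝔸-right : ∀ {n} x (as : Vec ℕ n) y bs → 𝔸 n x as y bs →
          ∀ a → Σ[ b ∈ ℕ ] 𝔸 (suc n) x (as ∷ʳ a) y (bs ∷ʳ b)
𝔸-right x as y bs R a with lookup-or-∉ as a
... | inj₁ (j , refl) = lookup bs j , 𝔸-∷ʳ-lookup x as y bs R j
... | inj₂ a∉as =
  let m , _ , am , m∉bs = Infinite-∉ bs (infA y) 0
  in m , 𝔸-∷ʳ-∉ x as y bs R a∉as m∉bs (λ _ → am) (λ _ → inj₁ am)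

𝔸-atom : ∀ {n} x (as : Vec ℕ n) y bs → 𝔸 n x as y bs → (R : PQ) (ks : Vec (Fin n) 1) →
         Val R x (map (lookup as) ks) → Val R y (map (lookup bs) ks)
𝔸-atom _ _ _ _ (_ , A⇒A , _)    P (k ∷ []) (inj₁ a) = inj₁ (A⇒A k a)
𝔸-atom _ _ _ _ (_ , _ , B⇒AB) P (k ∷ []) (inj₂ b) = B⇒AB k b
𝔸-atom _ _ _ _ (_ , A⇒A , _)    Q (k ∷ []) a        = A⇒A k a

lemma6 : ExcludedMiddle 0ℓ →
    IsBiAsimulation M₁ M₂ 𝔸₁₂ 𝔸₂₁ × 𝔸₁₂ 0 𝐯 [] 𝐰 []
lemma6 em = record
  { nonempty = inj₁ (0 , 𝐯 , [] , 𝐰 , [] , 𝔸-empty)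
  ; cond₁₂ = λ _ w as v bs R → record
      { atom  = 𝔸-atom w as v bs R
      ; back  = 𝔸-back em w as v bs R
      ; forth = λ w₀ w₀≺₁w → Product.map₂ (Product.map₁ proj₁) (𝔸-forth em w as v bs R w₀ (proj₁ w₀≺₁w))
      ; left  = 𝔸-left w as v bs R
      ; right = 𝔸-right w as v bs R }
  ; cond₂₁ = λ _ w as v bs R → record
      { atom  = 𝔸-atom w as v bs R
      ; back  = λ v₀ v≺₁v₀ → Product.map₂ (Product.map₁ proj₁) (𝔸-back em w as v bs R v₀ (proj₁ v≺₁v₀))
      ; forth = 𝔸-forth em w as v bs R
      ; left  = 𝔸-left w as v bs R
      ; right = 𝔸-right w as v bs R } }
  , 𝔸-empty
  where
  𝔸-empty : 𝔸 0 𝐯 [] 𝐰 []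
  𝔸-empty = (λ ()) , (λ ()) , (λ ())
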